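{- For fixed $q\ge2$ and $i$, the function $j\mapsto\max(M(q-1,j-1),R_{ji})$ on $0\le j\le i$ is unimodal with a unique minimum value.
   Context: $P$ is a path with vertices at coordinates $x_0<\dots<x_n$; $\tau>0$; $k\ge1$ fixed. Vertex $x_i$ has weight interval $[w_i^-,w_i^+]$, $0<w_i^-\le w_i^+$; a scenario $s$ assigns $w_i(s)\in[w_i^-,w_i^+]$, $\mathcal S$ the set of scenarios. For a subpath $Q=\{x_l,\dots,x_r\}$ and sink $y=x_t\in Q$: $\Theta_L(Q,y,s)=\max_{l\le i<t}\{(x_t-x_i)\tau+\sum_{j=l}^i w_j(s)\}$, $\Theta_R(Q,y,s)=\max_{t<i\le r}\{(x_i-x_t)\tau+\sum_{j=i}^r w_j(s)\}$ (empty maxima $0$), $\Theta^1=\max(\Theta_L,\Theta_R)$. A $k$-partition with sinks: consecutive subpaths $P_1,\dots,P_k$ partitioning the vertices with sinks $y_i\in P_i$; $\Theta^k=\max_i\Theta^1(P_i,y_i,s)$, $\Theta^k_{\rm opt}(P,s)$ its minimum; regret $=\Theta^k-\Theta^k_{\rm opt}$; a worst-case scenario maximizes regret over $\mathcal S$; dominant part $P_d$, $d$ smallest index maximizing $\Theta^1(P_i,y_i,s)$. Left-/right-dominant sub-scenario on $\{x_l,\dots,x_r\}$: for some $l\le i\le r$, $w_j=w_j^+$ (resp. $w_j^-$) for $l\le j<i$ and $w_j=w_j^-$ (resp. $w_j^+$) for $i\le j\le r$. $\mathcal S^*$: all scenarios that, for some $k$-partition with sinks, are worst-case scenarios for it with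 $w_i=w_i^-$ off the dominant part and left- or right-dominant sub-scenario in it. For $Q_{lr}=\{x_l,\dots,x_r\}$: $R_{lr}(s,x_t)=\Theta^1(Q_{lr},x_t,s)-\Theta^k_{\rm opt}(P,s)$, $R_{lr}(x_t)=\max_{s\in\mathcal S^*}R_{lr}(s,x_t)$, $R_{lr}=\min_{l\le t\le r}R_{lr}(x_t)$. $M(q,i)$ is the minimum over partitions of $\{x_0,\dots,x_i\}$ into at most $q$ consecutive subpaths $\{x_{l_1},\dots,x_{r_1}\},\dots$ of $\max_j R_{l_jr_j}$, with $M(q-1,-1)=-\infty$. A function $f$ is unimodal with a unique minimum value if there is $m$ with $f$ non-increasing for arguments $\le m$ and non-decreasing for arguments $\ge m$.
   Formalization: The vertex coordinates, the parameter τ, the weight bounds $w_i^-,w_i^+$ and all scenario weights are rational numbers. -}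

module Defs where

open import Data.Nat as ℕ using (ℕ; zero; suc; _∸_)
open import Data.Rational as ℚ using (ℚ; 0ℚ; _+_; _*_; _-_; _⊔_; _⊓_)
open import Data.List using (List; []; _∷_; map; foldr; upTo; length; _++_)
open import Data.List.Relation.Unary.All using (All)
open import Data.Product using (_×_; _,_; Σ; ∃; ∃-syntax)
open import Data.Sum using (_⊎_)
open import Data.Empty using (⊥)
open import Relation.Binary.PropositionalEquality using (_≡_)

-- Instance data: path x_0 < ... < x_n, capacity τ > 0,
-- weight intervals 0 < w⁻_i ≤ w⁺_i.  Functions on ℕ; only indices
-- 0..n are relevant.

record Instance (n : ℕ) : Set where
  field
    x     : ℕ → ℚ
    τ     : ℚ
    w⁻    : ℕ → ℚ
    w⁺    : ℕ → ℚ
    x-inc : ∀ i → i ℕ.< n → x i ℚ.< x (suc i)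
    τ-pos : 0ℚ ℚ.< τ
    w⁻-pos : ∀ i → i ℕ.≤ n → 0ℚ ℚ.< w⁻ i
    w⁻≤w⁺ : ∀ i → i ℕ.≤ n → w⁻ i ℚ.≤ w⁺ i

Scenario : Set
Scenario = ℕ → ℚ

range : ℕ → ℕ → List ℕ
range a b = map (a ℕ.+_) (upTo (b ∸ a))

sumFromTo : (ℕ → ℚ) → ℕ → ℕ → ℚ
sumFromTo f a b = foldr _+_ 0ℚ (map f (range a (suc b)))

-- maximum of a list of non-negative numbers; empty maximum is 0
max0 : List ℚ → ℚ
max0 = foldr _⊔_ 0ℚ

maxNE : ℚ → List ℚ → ℚ
maxNE h t = foldr _⊔_ h t

minNE : ℚ → List ℚ → ℚ
minNE h t = foldr _⊓_ h t

module _ {n : ℕ} (I : Instance n) where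
  open Instance I

  IsScenario : Scenario → Set
  IsScenario s = ∀ i → i ℕ.≤ n → (w⁻ i ℚ.≤ s i) × (s i ℚ.≤ w⁺ i)

  ΘL : ℕ → ℕ → ℕ → Scenario → ℚ
  ΘL l r t s = max0 (map (λ i → ((x t - x i) * τ) + sumFromTo s l i) (range l t))

  ΘR : ℕ → ℕ → ℕ → Scenario → ℚ
  ΘR l r t s = max0 (map (λ i → ((x i - x t) * τ) + sumFromTo s i r) (range (suc t) (suc r)))

  Θ1 : ℕ → ℕ → ℕ → Scenario → ℚ
  Θ1 l r t s = ΘL l r t s ⊔ ΘR l r t s

  -- A part with sink: (l , r , t) stands for {x_l,...,x_r} with sink x_t.
  Part : Set
  Part = ℕ × ℕ × ℕ

  Θ1P : Part → Scenario → ℚ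
  Θ1P (l , r , t) s = Θ1 l r t s

  interval : Part → ℕ × ℕ
  interval (l , r , t) = (l , r)

  SinkOK : Part → Set
  SinkOK (l , r , t) = (l ℕ.≤ t) × (t ℕ.≤ r)

  KPartition : ℕ → List Part → Set
  KPartition k ps = (length ps ≡ k) × Covers 0 n (map interval ps) × All SinkOK ps
    where
    Covers : ℕ → ℕ → List (ℕ × ℕ) → Set
    Covers a e [] = ⊥
    Covers a e ((l , r) ∷ []) = (l ≡ a) × (l ℕ.≤ r) × (r ≡ e)
    Covers a e ((l , r) ∷ (p ∷ qs)) = (l ≡ a) × (l ℕ.≤ r) × Covers (suc r) e (p ∷ qs)

  Θk : List Part → Scenario → ℚ
  Θk ps s = max0 (map (λ p → Θ1P p s) ps)

  IsOptValue : ℕ → Scenario → ℚ → Set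
  IsOptValue k s v = (∃[ ps ] (KPartition k ps × (Θk ps s ≡ v)))
                   × (∀ ps → KPartition k ps → v ℚ.≤ Θk ps s)

  module WithOpt (k : ℕ) (opt : Scenario → ℚ) where

    Regret : List Part → Scenario → ℚ
    Regret ps s = Θk ps s - opt s

    IsWorstCase : List Part → Scenario → Set
    IsWorstCase ps s = IsScenario s × (∀ s' → IsScenario s' → Regret ps s' ℚ.≤ Regret ps s)

    LeftDominant : ℕ → ℕ → Scenario → Set
    LeftDominant l r s = ∃[ i ] ((l ℕ.≤ i) × (i ℕ.≤ r)
      × (∀ j → l ℕ.≤ j → j ℕ.< i → s j ≡ w⁺ j)
      × (∀ j → i ℕ.≤ j → j ℕ.≤ r → s j ≡ w⁻ j))

    RightDominant : ℕ → ℕ → Scenario → Set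
    RightDominant l r s = ∃[ i ] ((l ℕ.≤ i) × (i ℕ.≤ r)
      × (∀ j → l ℕ.≤ j → j ℕ.< i → s j ≡ w⁻ j)
      × (∀ j → i ℕ.≤ j → j ℕ.≤ r → s j ≡ w⁺ j))

    -- s ∈ S*: there is a k-partition with sinks ps = pre ++ d ∷ post,
    -- s is worst-case for ps, d is the dominant part (first part attaining
    -- the maximum Θ^1), s = w⁻ outside d and left-/right-dominant on d.
    InSStar : Scenario → Set
    InSStar s = ∃[ pre ] ∃[ l ] ∃[ r ] ∃[ t ] ∃[ post ]
      ( let ps = pre ++ ((l , r , t) ∷ post) in
        KPartition k ps
      × IsWorstCase ps s
      × (Θ1 l r t s ≡ Θk ps s)
      × All (λ p → Θ1P p s ℚ.< Θk ps s) pre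
      × (∀ j → j ℕ.≤ n → (j ℕ.< l ⊎ r ℕ.< j) → s j ≡ w⁻ j)
      × (LeftDominant l r s ⊎ RightDominant l r s))

    Rs : ℕ → ℕ → ℕ → Scenario → ℚ
    Rs l r t s = Θ1 l r t s - opt s

    IsRValue : ℕ → ℕ → ℕ → ℚ → Set
    IsRValue l r t v = (∃[ s ] (InSStar s × (Rs l r t s ≡ v)))
                     × (∀ s → InSStar s → Rs l r t s ℚ.≤ v)

  -- R_{lr} = min_{l ≤ t ≤ r} R_{lr}(x_t), from a table Rt l r t = R_{lr}(x_t)
  Rlr : (ℕ → ℕ → ℕ → ℚ) → ℕ → ℕ → ℚ
  Rlr Rt l r = minNE (Rt l r l) (map (Rt l r) (range (suc l) (suc r)))

  CoversI : ℕ → ℕ → List (ℕ × ℕ) → Set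
  CoversI a e [] = ⊥
  CoversI a e ((l , r) ∷ []) = (l ≡ a) × (l ℕ.≤ r) × (r ≡ e)
  CoversI a e ((l , r) ∷ (p ∷ qs)) = (l ≡ a) × (l ℕ.≤ r) × CoversI (suc r) e (p ∷ qs)

  maxR : (ℕ → ℕ → ℕ → ℚ) → List (ℕ × ℕ) → ℚ
  maxR Rt [] = 0ℚ
  maxR Rt ((l , r) ∷ qs) = maxNE (Rlr Rt l r) (map (λ { (a , b) → Rlr Rt a b }) qs)

  IsMValue : (ℕ → ℕ → ℕ → ℚ) → ℕ → ℕ → ℚ → Set
  IsMValue Rt q i v = (∃[ qs ] (CoversI 0 i qs × (length qs ℕ.≤ q) × (maxR Rt qs ≡ v)))
                    × (∀ qs → CoversI 0 i qs → length qs ℕ.≤ q → v ℚ.≤ maxR Rt qs)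

UnimodalOn : ℕ → (ℕ → ℚ) → Set
UnimodalOn i f = ∃[ m ] ((m ℕ.≤ i)
  × (∀ a b → a ℕ.≤ b → b ℕ.≤ m → f b ℚ.≤ f a)
  × (∀ a b → m ℕ.≤ a → a ℕ.≤ b → b ℕ.≤ i → f a ℚ.≤ f b))

-- j ↦ max(M(q-1, j-1), R_{ji}), with M(q-1,-1) = -∞ so that j = 0 gives R_{0i}
objective : {n : ℕ} → Instance n → (ℕ → ℕ → ℕ → ℚ) → (ℕ → ℕ → ℚ) → ℕ → ℕ → ℕ → ℚ
objective I Rt M q i zero = Rlr I Rt 0 i
objective I Rt M q i (suc j) = M (q ∸ 1) j ⊔ Rlr I Rt (suc j) i

-- For a fixed sink, Θ¹ can only grow when a vertex is added at either end of a subpath: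
-- weights are nonnegative and coordinates increase.  All values R_{lr}(x_t) are maxima
-- of Θ¹ − Θ^k_opt over the same scenario set S*, so R_{lr} is nonincreasing in l and
-- nondecreasing in r.  Truncating a partition of {x_0,…,x_{i+1}} to {x_0,…,x_i} therefore
-- does not increase any part's R, so M(q,·) is nondecreasing.  The objective
-- max(M(q−1,j−1), R_{ji}) is thus the maximum of a nondecreasing and a nonincreasing
-- function of j, hence quasiconvex, and a quasiconvex function on {0,…,i} is unimodal
-- around any of its minimisers.
module Submission where

open import Defs
open import Data.Nat as ℕ using (ℕ; zero; suc; _∸_; z≤n; s≤s)
import Data.Nat.Properties as ℕₚ
open import Data.Rational as ℚ using (ℚ; 0ℚ; _+_; _*_; _-_; _⊔_; -_)
open import Data.Rational.Properties
open import Data.List using (List; []; _∷_; _∷ʳ_; map; foldr; upTo; applyUpTo; length)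
import Data.List.Properties as List
open import Data.List.Relation.Unary.All as All using (All; []; _∷_)
open import Data.List.Relation.Unary.Any as Any using (Any; here; there)
import Data.List.Relation.Unary.Any.Properties as Any
import Data.List.Relation.Unary.All.Properties as All
open import Data.List.Membership.Propositional using (_∈_; lose)
open import Data.List.Membership.Propositional.Properties
  using (∈-map⁺; ∈-map⁻; ∈-upTo⁺; ∈-upTo⁻)
open import Data.Product using (_×_; _,_; proj₁; proj₂; ∃-syntax)
open import Data.Sum using (_⊎_; inj₁; inj₂; [_,_])
open import Function using (flip)
open import Relation.Binary.Core using (Rel)
open import Relation.Binary.Definitions using (Reflexive; Transitive)
open import Relation.Binary.PropositionalEquality
  using (_≡_; refl; sym; cong; cong₂; trans; subst; module ≡-Reasoning)
open import Relation.Nullary using (Dec; yes; no)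

≤-maxNE : ∀ {x} h t → x ℚ.≤ h ⊎ Any (x ℚ.≤_) t → x ℚ.≤ maxNE h t
≤-maxNE = List.foldr-preservesᵒ (λ a b → [ p≤q⇒p≤q⊔r b , p≤q⇒p≤r⊔q a ])

maxNE-lub : ∀ {c h t} → h ℚ.≤ c → All (ℚ._≤ c) t → maxNE h t ℚ.≤ c
maxNE-lub = List.foldr-preservesᵇ ⊔-lub

minNE-≤ : ∀ {x} h t → h ℚ.≤ x ⊎ Any (ℚ._≤ x) t → minNE h t ℚ.≤ x
minNE-≤ = List.foldr-preservesᵒ (λ a b → [ p≤q⇒p⊓r≤q b , p≤q⇒r⊓p≤q a ])

≤-minNE : ∀ {c h t} → c ℚ.≤ h → All (c ℚ.≤_) t → c ℚ.≤ minNE h t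
≤-minNE = List.foldr-preservesᵇ ⊓-glb

max0-nonNeg : ∀ xs → 0ℚ ℚ.≤ max0 xs
max0-nonNeg xs = ≤-maxNE 0ℚ xs (inj₁ ≤-refl)

module _ {a ℓ} {A : Set a} {_∼_ : Rel A ℓ} (∼-refl : Reflexive _∼_) (∼-trans : Transitive _∼_) where

  stepwise⇒monotone : ∀ (f : ℕ → A) {N} → (∀ {j} → suc j ℕ.≤ N → f j ∼ f (suc j)) →
    ∀ {i j} → i ℕ.≤ j → j ℕ.≤ N → f i ∼ f j
  stepwise⇒monotone f step {j = zero}  z≤n _ = ∼-refl
  stepwise⇒monotone f step {i} {suc j} i≤1+j 1+j≤N with ℕₚ.m≤n⇒m<n∨m≡n i≤1+j
  ... | inj₂ refl      = ∼-refl
  ... | inj₁ (s≤s i≤j) = ∼-trans (stepwise⇒monotone f step i≤j (ℕₚ.<⇒≤ 1+j≤N)) (step 1+j≤N)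

m<n∸o⇒o+m<n : ∀ o n m → m ℕ.< n ∸ o → o ℕ.+ m ℕ.< n
m<n∸o⇒o+m<n zero    n       m m<n   = m<n
m<n∸o⇒o+m<n (suc o) (suc n) m m<n∸o = s≤s (m<n∸o⇒o+m<n o n m m<n∸o)

∈-range⁺ : ∀ {a b k} → a ℕ.≤ k → k ℕ.< b → k ∈ range a b
∈-range⁺ {a} {b} a≤k k<b =
  subst (_∈ range a b) (ℕₚ.m+[n∸m]≡n a≤k) (∈-map⁺ (a ℕ.+_) (∈-upTo⁺ (ℕₚ.∸-monoˡ-< k<b a≤k)))

∈-range⁻ : ∀ {a b k} → k ∈ range a b → a ℕ.≤ k × k ℕ.< b
∈-range⁻ {a} {b} k∈ with ∈-map⁻ (a ℕ.+_) k∈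
... | j , j∈ , refl = ℕₚ.m≤m+n a j , m<n∸o⇒o+m<n a b j (∈-upTo⁻ j∈)

All-range⁺ : ∀ {p} {P : ℕ → Set p} {a b} → (∀ k → a ℕ.≤ k → k ℕ.< b → P k) → All P (range a b)
All-range⁺ P-range = All.tabulate λ k∈ → let a≤k , k<b = ∈-range⁻ k∈ in P-range _ a≤k k<b

Any-range⁺ : ∀ {p} {P : ℕ → Set p} {a b k} → a ℕ.≤ k → k ℕ.< b → P k → Any P (range a b)
Any-range⁺ a≤k k<b = lose (∈-range⁺ a≤k k<b)

range-empty : ∀ a → range a a ≡ []
range-empty a rewrite ℕₚ.n∸n≡0 a = refl

range-cons : ∀ {a b} → a ℕ.< b → range a b ≡ a ∷ range (suc a) b
range-cons {a} {b} a<b rewrite ℕₚ.+-∸-assoc 1 a<b = cong₂ _∷_ (ℕₚ.+-identityʳ a) (begin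
    map (a ℕ.+_) (applyUpTo suc m)      ≡⟨ cong (map (a ℕ.+_)) (List.map-upTo suc m) ⟨
    map (a ℕ.+_) (map suc (upTo m))     ≡⟨ List.map-∘ (upTo m) ⟨
    map (λ k → a ℕ.+ suc k) (upTo m)    ≡⟨ List.map-cong (ℕₚ.+-suc a) (upTo m) ⟩
    map (suc a ℕ.+_) (upTo m)           ∎)
  where
  open ≡-Reasoning
  m = b ∸ suc a

range-snoc : ∀ {a b} → a ℕ.≤ b → range a (suc b) ≡ range a b ∷ʳ b
range-snoc {a} {b} a≤b rewrite ℕₚ.+-∸-assoc 1 a≤b = begin
    map (a ℕ.+_) (upTo (suc m))         ≡⟨ cong (map (a ℕ.+_)) (List.upTo-∷ʳ m) ⟨
    map (a ℕ.+_) (upTo m ∷ʳ m)          ≡⟨ List.map-++ (a ℕ.+_) (upTo m) (m ∷ []) ⟩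
    map (a ℕ.+_) (upTo m) ∷ʳ (a ℕ.+ m)  ≡⟨ cong (map (a ℕ.+_) (upTo m) ∷ʳ_) (ℕₚ.m+[n∸m]≡n a≤b) ⟩
    map (a ℕ.+_) (upTo m) ∷ʳ b          ∎
  where
  open ≡-Reasoning
  m = b ∸ a

max0-range-empty : ∀ (f : ℕ → ℚ) a → max0 (map f (range a a)) ≡ 0ℚ
max0-range-empty f a rewrite range-empty a = refl

max0-range-mono : ∀ (f g : ℕ → ℚ) a b a′ b′ → a′ ℕ.≤ a → b ℕ.≤ b′ →
  (∀ k → a ℕ.≤ k → k ℕ.< b → f k ℚ.≤ g k) →
  max0 (map f (range a b)) ℚ.≤ max0 (map g (range a′ b′))
max0-range-mono f g a b a′ b′ a′≤a b≤b′ f≤g =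
  maxNE-lub (max0-nonNeg (map g (range a′ b′))) (All.map⁺ (All-range⁺ λ k a≤k k<b →
    ≤-maxNE 0ℚ _ (inj₂ (Any.map⁺
      (Any-range⁺ (ℕₚ.≤-trans a′≤a a≤k) (ℕₚ.<-≤-trans k<b b≤b′) (f≤g k a≤k k<b))))))

foldr-+-∷ʳ : ∀ xs y → foldr _+_ 0ℚ (xs ∷ʳ y) ≡ foldr _+_ 0ℚ xs + y
foldr-+-∷ʳ []       y = trans (+-identityʳ y) (sym (+-identityˡ y))
foldr-+-∷ʳ (x ∷ xs) y rewrite foldr-+-∷ʳ xs y = sym (+-assoc x _ y)

module _ (s : ℕ → ℚ) where

  sumFromTo-cons : ∀ {j b} → j ℕ.≤ b → sumFromTo s j b ≡ s j + sumFromTo s (suc j) b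
  sumFromTo-cons j≤b rewrite range-cons (s≤s j≤b) = refl

  sumFromTo-snoc : ∀ {a b} → a ℕ.≤ suc b → sumFromTo s a (suc b) ≡ sumFromTo s a b + s (suc b)
  sumFromTo-snoc {a} {b} a≤1+b = begin
      foldr _+_ 0ℚ (map s (range a (suc (suc b))))
        ≡⟨ cong (λ is → foldr _+_ 0ℚ (map s is)) (range-snoc a≤1+b) ⟩
      foldr _+_ 0ℚ (map s (range a (suc b) ∷ʳ suc b))
        ≡⟨ cong (foldr _+_ 0ℚ) (List.map-++ s (range a (suc b)) (suc b ∷ [])) ⟩
      foldr _+_ 0ℚ (map s (range a (suc b)) ∷ʳ s (suc b))
        ≡⟨ foldr-+-∷ʳ (map s (range a (suc b))) (s (suc b)) ⟩
      sumFromTo s a b + s (suc b)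
        ∎
    where open ≡-Reasoning

  sumFromTo-dropFirst : ∀ {j b} → 0ℚ ℚ.≤ s j → j ℕ.≤ b → sumFromTo s (suc j) b ℚ.≤ sumFromTo s j b
  sumFromTo-dropFirst {j} {b} 0≤sj j≤b = begin
      sumFromTo s (suc j) b        ≡⟨ +-identityˡ _ ⟨
      0ℚ + sumFromTo s (suc j) b   ≤⟨ +-monoˡ-≤ _ 0≤sj ⟩
      s j + sumFromTo s (suc j) b  ≡⟨ sumFromTo-cons j≤b ⟨
      sumFromTo s j b              ∎
    where open ≤-Reasoning

  sumFromTo-addLast : ∀ {a b} → 0ℚ ℚ.≤ s (suc b) → a ℕ.≤ suc b →
    sumFromTo s a b ℚ.≤ sumFromTo s a (suc b)
  sumFromTo-addLast {a} {b} 0≤sb a≤1+b = begin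
      sumFromTo s a b               ≡⟨ +-identityʳ _ ⟨
      sumFromTo s a b + 0ℚ          ≤⟨ +-monoʳ-≤ (sumFromTo s a b) 0≤sb ⟩
      sumFromTo s a b + s (suc b)   ≡⟨ sumFromTo-snoc a≤1+b ⟨
      sumFromTo s a (suc b)         ∎
    where open ≤-Reasoning

module _ {n : ℕ} (I : Instance n) where
  open Instance I

  private instance
    τ-nonNeg : ℚ.NonNegative τ
    τ-nonNeg = ℚ.nonNegative (<⇒≤ τ-pos)

  x-step : ∀ {t} → t ℕ.< n → x t ℚ.≤ x (suc t)
  x-step t<n = <⇒≤ (x-inc _ t<n)

  ΘL-at : ℕ → ℕ → Scenario → ℕ → ℚ
  ΘL-at l t s i = (x t - x i) * τ + sumFromTo s l i

  ΘR-at : ℕ → ℕ → Scenario → ℕ → ℚ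
  ΘR-at r t s i = (x i - x t) * τ + sumFromTo s i r

  Θ1-nonNeg : ∀ l r t s → 0ℚ ℚ.≤ Θ1 I l r t s
  Θ1-nonNeg l r t s =
    ≤-trans (max0-nonNeg (map (ΘL-at l t s) (range l t))) (p≤p⊔q (ΘL I l r t s) (ΘR I l r t s))

  ΘL-dropFirst : ∀ {l r t s} → 0ℚ ℚ.≤ s l → ΘL I (suc l) r t s ℚ.≤ ΘL I l r t s
  ΘL-dropFirst {l} {t = t} {s} 0≤sl =
    max0-range-mono (ΘL-at (suc l) t s) (ΘL-at l t s) (suc l) t l t (ℕₚ.n≤1+n l) ℕₚ.≤-refl
      λ k l<k _ → +-monoʳ-≤ ((x t - x k) * τ) (sumFromTo-dropFirst s 0≤sl (ℕₚ.<⇒≤ l<k))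

  ΘR-addLast : ∀ {l r t s} → 0ℚ ℚ.≤ s (suc r) → ΘR I l r t s ℚ.≤ ΘR I l (suc r) t s
  ΘR-addLast {r = r} {t} {s} 0≤sr =
    max0-range-mono (ΘR-at r t s) (ΘR-at (suc r) t s) (suc t) (suc r) (suc t) (suc (suc r))
      ℕₚ.≤-refl (ℕₚ.n≤1+n (suc r)) λ k _ k<1+r →
      +-monoʳ-≤ ((x k - x t) * τ) (sumFromTo-addLast s 0≤sr (ℕₚ.m≤n⇒m≤1+n (ℕₚ.≤-pred k<1+r)))

  ΘL-advanceSink : ∀ {l r t s} → t ℕ.< n → ΘL I l r t s ℚ.≤ ΘL I l r (suc t) s
  ΘL-advanceSink {l} {t = t} {s} t<n =
    max0-range-mono (ΘL-at l t s) (ΘL-at l (suc t) s) l t l (suc t) ℕₚ.≤-refl (ℕₚ.n≤1+n t)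
      λ k _ _ → +-monoˡ-≤ (sumFromTo s l k) (*-monoʳ-≤-nonNeg τ (+-monoˡ-≤ (- x k) (x-step t<n)))

  ΘR-advanceSink : ∀ {l r t s} → t ℕ.< n → ΘR I l r (suc t) s ℚ.≤ ΘR I l r t s
  ΘR-advanceSink {r = r} {t} {s} t<n =
    max0-range-mono (ΘR-at r (suc t) s) (ΘR-at r t s) (suc (suc t)) (suc r) (suc t) (suc r)
      (ℕₚ.n≤1+n (suc t)) ℕₚ.≤-refl λ k _ _ →
      +-monoˡ-≤ (sumFromTo s k r) (*-monoʳ-≤-nonNeg τ (+-monoʳ-≤ (x k) (neg-antimono-≤ (x-step t<n))))

  Θ1-dropFirst : ∀ {l r t s} → 0ℚ ℚ.≤ s l → Θ1 I (suc l) r t s ℚ.≤ Θ1 I l r t s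
  Θ1-dropFirst {l} {r} {t} {s} 0≤sl = ⊔-monoˡ-≤ (ΘR I l r t s) (ΘL-dropFirst {l} {r} {t} {s} 0≤sl)

  Θ1-addLast : ∀ {l r t s} → 0ℚ ℚ.≤ s (suc r) → Θ1 I l r t s ℚ.≤ Θ1 I l (suc r) t s
  Θ1-addLast {l} {r} {t} {s} 0≤sr = ⊔-monoʳ-≤ (ΘL I l r t s) (ΘR-addLast {l} {r} {t} {s} 0≤sr)

  Θ1-dropFirstSink : ∀ {l r s} → l ℕ.< n → Θ1 I (suc l) r (suc l) s ℚ.≤ Θ1 I l r l s
  Θ1-dropFirstSink {l} {r} {s} l<n = ⊔-lub
    (≤-trans (≤-reflexive (max0-range-empty (ΘL-at (suc l) (suc l) s) (suc l))) (Θ1-nonNeg l r l s))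
    (≤-trans (ΘR-advanceSink {l} {r} {l} {s} l<n) (p≤q⊔p (ΘL I l r l s) (ΘR I l r l s)))

  Θ1-addLastSink : ∀ {l r s} → r ℕ.< n → Θ1 I l r r s ℚ.≤ Θ1 I l (suc r) (suc r) s
  Θ1-addLastSink {l} {r} {s} r<n = ⊔-lub
    (≤-trans (ΘL-advanceSink {l} {r} {r} {s} r<n)
      (p≤p⊔q (ΘL I l (suc r) (suc r) s) (ΘR I l (suc r) (suc r) s)))
    (≤-trans (≤-reflexive (max0-range-empty (ΘR-at r r s) (suc r))) (Θ1-nonNeg l (suc r) (suc r) s))

module _ {n : ℕ} (I : Instance n) (k : ℕ) (opt : Scenario → ℚ) where
  open WithOpt I k opt

  SStar⇒scenario : ∀ {s} → InSStar s → IsScenario I s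
  SStar⇒scenario (_ , _ , _ , _ , _ , _ , (s-isScenario , _) , _) = s-isScenario

  IsRValue-mono : ∀ {l r t l′ r′ t′ v v′} → IsRValue l′ r′ t′ v′ → IsRValue l r t v →
    (∀ s → IsScenario I s → Θ1 I l′ r′ t′ s ℚ.≤ Θ1 I l r t s) → v′ ℚ.≤ v
  IsRValue-mono {v = v} ((s , s∈S* , Rs≡v′) , _) (_ , Rs≤v) Θ1≤ =
    subst (ℚ._≤ v) Rs≡v′
      (≤-trans (+-monoˡ-≤ (- opt s) (Θ1≤ s (SStar⇒scenario s∈S*))) (Rs≤v s s∈S*))

module Regret {n : ℕ} (I : Instance n) (k : ℕ) (opt : Scenario → ℚ) (Rt : ℕ → ℕ → ℕ → ℚ)
  (Rt-isR : ∀ l r t → l ℕ.≤ t → t ℕ.≤ r → r ℕ.≤ n →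
            WithOpt.IsRValue I k opt l r t (Rt l r t)) where
  open Instance I

  scenario-nonNeg : ∀ {s} → IsScenario I s → ∀ {j} → j ℕ.≤ n → 0ℚ ℚ.≤ s j
  scenario-nonNeg s-isScenario {j} j≤n = ≤-trans (<⇒≤ (w⁻-pos j j≤n)) (proj₁ (s-isScenario j j≤n))

  Rlr≤Rt : ∀ {l r t} → l ℕ.≤ t → t ℕ.≤ r → Rlr I Rt l r ℚ.≤ Rt l r t
  Rlr≤Rt {l} {r} l≤t t≤r with ℕₚ.m≤n⇒m<n∨m≡n l≤t
  ... | inj₂ refl = minNE-≤ (Rt l r l) (map (Rt l r) (range (suc l) (suc r))) (inj₁ ≤-refl)
  ... | inj₁ l<t  = minNE-≤ (Rt l r l) (map (Rt l r) (range (suc l) (suc r)))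
                      (inj₂ (Any.map⁺ (Any-range⁺ l<t (s≤s t≤r) ≤-refl)))

  ≤-Rlr : ∀ {c l r} → l ℕ.≤ r → (∀ t → l ℕ.≤ t → t ℕ.≤ r → c ℚ.≤ Rt l r t) → c ℚ.≤ Rlr I Rt l r
  ≤-Rlr {l = l} l≤r c≤Rt = ≤-minNE (c≤Rt l ℕₚ.≤-refl l≤r) (All.map⁺ (All-range⁺ λ t l<t t<1+r →
    c≤Rt t (ℕₚ.<⇒≤ l<t) (ℕₚ.≤-pred t<1+r)))

  Rlr-mono : ∀ {l r l′ r′} → l ℕ.≤ r → r ℕ.≤ n → r′ ℕ.≤ n →
    (∀ t → l ℕ.≤ t → t ℕ.≤ r → ∃[ t′ ] (l′ ℕ.≤ t′ × t′ ℕ.≤ r′ ×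
      (∀ s → IsScenario I s → Θ1 I l′ r′ t′ s ℚ.≤ Θ1 I l r t s))) →
    Rlr I Rt l′ r′ ℚ.≤ Rlr I Rt l r
  Rlr-mono {l} {r} {l′} {r′} l≤r r≤n r′≤n dominated = ≤-Rlr l≤r λ t l≤t t≤r →
    let t′ , l′≤t′ , t′≤r′ , Θ1≤ = dominated t l≤t t≤r in
    ≤-trans (Rlr≤Rt l′≤t′ t′≤r′)
      (IsRValue-mono I k opt {l} {r} {t} {l′} {r′} {t′}
        (Rt-isR l′ r′ t′ l′≤t′ t′≤r′ r′≤n) (Rt-isR l r t l≤t t≤r r≤n) Θ1≤)

  Rlr-dropFirst : ∀ {j i} → suc j ℕ.≤ i → i ℕ.≤ n → Rlr I Rt (suc j) i ℚ.≤ Rlr I Rt j i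
  Rlr-dropFirst {j} {i} 1+j≤i i≤n = Rlr-mono (ℕₚ.<⇒≤ 1+j≤i) i≤n i≤n dominated
    where
    dominated : ∀ t → j ℕ.≤ t → t ℕ.≤ i → ∃[ t′ ] (suc j ℕ.≤ t′ × t′ ℕ.≤ i ×
      (∀ s → IsScenario I s → Θ1 I (suc j) i t′ s ℚ.≤ Θ1 I j i t s))
    dominated t j≤t t≤i with ℕₚ.m≤n⇒m<n∨m≡n j≤t
    ... | inj₂ refl = suc j , ℕₚ.≤-refl , 1+j≤i , λ s _ →
      Θ1-dropFirstSink I (ℕₚ.<-≤-trans 1+j≤i i≤n)
    ... | inj₁ j<t  = t , j<t , t≤i , λ s s-isScenario →
      Θ1-dropFirst I {j} {i} {t} {s}
        (scenario-nonNeg s-isScenario (ℕₚ.≤-trans j≤t (ℕₚ.≤-trans t≤i i≤n)))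

  Rlr-addLast : ∀ {l r} → l ℕ.≤ r → suc r ℕ.≤ n → Rlr I Rt l r ℚ.≤ Rlr I Rt l (suc r)
  Rlr-addLast {l} {r} l≤r 1+r≤n = Rlr-mono (ℕₚ.m≤n⇒m≤1+n l≤r) 1+r≤n (ℕₚ.<⇒≤ 1+r≤n) dominated
    where
    dominated : ∀ t → l ℕ.≤ t → t ℕ.≤ suc r → ∃[ t′ ] (l ℕ.≤ t′ × t′ ℕ.≤ r ×
      (∀ s → IsScenario I s → Θ1 I l r t′ s ℚ.≤ Θ1 I l (suc r) t s))
    dominated t l≤t t≤1+r with ℕₚ.m≤n⇒m<n∨m≡n t≤1+r
    ... | inj₂ refl  = r , l≤r , ℕₚ.≤-refl , λ s _ → Θ1-addLastSink I {l} {r} {s} 1+r≤n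
    ... | inj₁ t<1+r = t , l≤t , ℕₚ.≤-pred t<1+r , λ s s-isScenario →
      Θ1-addLast I {l} {r} {t} {s} (scenario-nonNeg s-isScenario 1+r≤n)

  Rlr-antitoneˡ : ∀ {a b i} → a ℕ.≤ b → b ℕ.≤ i → i ℕ.≤ n → Rlr I Rt b i ℚ.≤ Rlr I Rt a i
  Rlr-antitoneˡ {i = i} a≤b b≤i i≤n =
    stepwise⇒monotone {_∼_ = flip ℚ._≤_} ≤-refl (flip ≤-trans)
      (λ j → Rlr I Rt j i) (λ 1+j≤i → Rlr-dropFirst 1+j≤i i≤n) a≤b b≤i

  RlrOf : ℕ × ℕ → ℚ
  RlrOf (l , r) = Rlr I Rt l r

  _≼_ : List (ℕ × ℕ) → List (ℕ × ℕ) → Set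
  ps′ ≼ ps = All (λ p′ → Any (λ p → RlrOf p′ ℚ.≤ RlrOf p) ps) ps′

  ≤-maxR : ∀ {c ps} → Any (λ p → c ℚ.≤ RlrOf p) ps → c ℚ.≤ maxR I Rt ps
  ≤-maxR {ps = (l , r) ∷ ps} (here c≤)  = ≤-maxNE (Rlr I Rt l r) (map RlrOf ps) (inj₁ c≤)
  ≤-maxR {ps = (l , r) ∷ ps} (there c≤) = ≤-maxNE (Rlr I Rt l r) _ (inj₂ (Any.map⁺ c≤))

  maxR-lub : ∀ {c p ps} → All (λ p → RlrOf p ℚ.≤ c) (p ∷ ps) → maxR I Rt (p ∷ ps) ℚ.≤ c
  maxR-lub (≤c ∷ ≤cs) = maxNE-lub ≤c (All.map⁺ ≤cs)

  maxR-mono : ∀ {p ps′ ps} → (p ∷ ps′) ≼ ps → maxR I Rt (p ∷ ps′) ℚ.≤ maxR I Rt ps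
  maxR-mono dominated = maxR-lub (All.map ≤-maxR dominated)

  CoversI⇒≤ : ∀ {a e ps} → CoversI I a e ps → a ℕ.≤ e
  CoversI⇒≤ {ps = _ ∷ []}    (refl , l≤r , refl) = l≤r
  CoversI⇒≤ {ps = _ ∷ _ ∷ _} (refl , l≤r , cov)  = ℕₚ.≤-trans l≤r (ℕₚ.<⇒≤ (CoversI⇒≤ cov))

  Truncation : ℕ → ℕ → List (ℕ × ℕ) → Set
  Truncation a e ps = ∃[ ps′ ] (CoversI I a e ps′ × length ps′ ℕ.≤ length ps × ps′ ≼ ps)

  truncation-cons : ∀ {e l r p ps} → l ℕ.≤ r → CoversI I (suc r) (suc e) (p ∷ ps) →
    Dec (suc r ℕ.≤ e) → (suc r ℕ.≤ e → Truncation (suc r) e (p ∷ ps)) →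
    Truncation l e ((l , r) ∷ p ∷ ps)
  truncation-cons {e} {l} {r} l≤r cov (no 1+r≰e) _ =
    (l , r) ∷ [] , (refl , l≤r , r≡e) , s≤s z≤n , here ≤-refl ∷ []
    where
    r≡e : r ≡ e
    r≡e = ℕₚ.≤-antisym (ℕₚ.≤-pred (CoversI⇒≤ cov)) (ℕₚ.≤-pred (ℕₚ.≰⇒> 1+r≰e))
  truncation-cons {l = l} {r} l≤r _ (yes 1+r≤e) truncate-rest with truncate-rest 1+r≤e
  ... | p′ ∷ ps′ , cov′ , len≤ , dominated =
    (l , r) ∷ p′ ∷ ps′ , (refl , l≤r , cov′) , s≤s len≤ , here ≤-refl ∷ All.map there dominated

  -- The last part loses the vertex x_{e+1}, and disappears if that was its only vertex.
  truncate : ∀ {a e} ps → a ℕ.≤ e → suc e ℕ.≤ n → CoversI I a (suc e) ps → Truncation a e ps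
  truncate {a} {e} (_ ∷ []) a≤e 1+e≤n (refl , _ , refl) =
    (a , e) ∷ [] , (refl , a≤e , refl) , ℕₚ.≤-refl , here (Rlr-addLast a≤e 1+e≤n) ∷ []
  truncate {e = e} ((l , r) ∷ p ∷ ps) _ 1+e≤n (refl , l≤r , cov) =
    truncation-cons l≤r cov (suc r ℕ.≤? e) λ 1+r≤e → truncate (p ∷ ps) 1+r≤e 1+e≤n cov

  module _ (M : ℕ → ℕ → ℚ) (M-isM : ∀ q i → 1 ℕ.≤ q → i ℕ.≤ n → IsMValue I Rt q i (M q i)) where

    M-step : ∀ {q j} → 1 ℕ.≤ q → suc j ℕ.≤ n → M q j ℚ.≤ M q (suc j)
    M-step {q} {j} 1≤q 1+j≤n with proj₁ (M-isM q (suc j) 1≤q 1+j≤n)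
    ... | ps , cov , len≤q , maxR≡M with truncate ps ℕ.z≤n 1+j≤n cov
    ...   | p′ ∷ ps′ , cov′ , len′≤len , dominated = begin
      M q j                  ≤⟨ M-optimal (p′ ∷ ps′) cov′ (ℕₚ.≤-trans len′≤len len≤q) ⟩
      maxR I Rt (p′ ∷ ps′)   ≤⟨ maxR-mono dominated ⟩
      maxR I Rt ps           ≡⟨ maxR≡M ⟩
      M q (suc j)            ∎
      where
      open ≤-Reasoning
      M-optimal : ∀ ps → CoversI I 0 j ps → length ps ℕ.≤ q → M q j ℚ.≤ maxR I Rt ps
      M-optimal = proj₂ (M-isM q j 1≤q (ℕₚ.<⇒≤ 1+j≤n))

    M-mono : ∀ {q a b} → 1 ℕ.≤ q → a ℕ.≤ b → b ℕ.≤ n → M q a ℚ.≤ M q b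
    M-mono {q} 1≤q = stepwise⇒monotone {_∼_ = ℚ._≤_} ≤-refl ≤-trans (M q) (M-step 1≤q)

QuasiconvexOn : ℕ → (ℕ → ℚ) → Set
QuasiconvexOn i f = ∀ a b c → a ℕ.≤ b → b ℕ.≤ c → c ℕ.≤ i → f b ℚ.≤ f a ⊔ f c

minimiserOn : ∀ i (f : ℕ → ℚ) → ∃[ m ] (m ℕ.≤ i × (∀ a → a ℕ.≤ i → f m ℚ.≤ f a))
minimiserOn zero    f = 0 , z≤n , λ { .0 z≤n → ≤-refl }
minimiserOn (suc i) f with minimiserOn i f
... | m , m≤i , fm≤ with ≤-total (f m) (f (suc i))
...   | inj₁ fm≤fi = m , ℕₚ.m≤n⇒m≤1+n m≤i , λ a a≤1+i →
        [ (λ a<1+i → fm≤ a (ℕₚ.≤-pred a<1+i)) , (λ { refl → fm≤fi }) ] (ℕₚ.m≤n⇒m<n∨m≡n a≤1+i)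
...   | inj₂ fi≤fm = suc i , ℕₚ.≤-refl , λ a a≤1+i →
        [ (λ a<1+i → ≤-trans fi≤fm (fm≤ a (ℕₚ.≤-pred a<1+i))) , (λ { refl → ≤-refl }) ]
          (ℕₚ.m≤n⇒m<n∨m≡n a≤1+i)

quasiconvex⇒unimodal : ∀ i (f : ℕ → ℚ) → QuasiconvexOn i f → UnimodalOn i f
quasiconvex⇒unimodal i f quasiconvex with minimiserOn i f
... | m , m≤i , fm≤ = m , m≤i , nonincreasing , nondecreasing
  where
  nonincreasing : ∀ a b → a ℕ.≤ b → b ℕ.≤ m → f b ℚ.≤ f a
  nonincreasing a b a≤b b≤m = ≤-trans (quasiconvex a b m a≤b b≤m m≤i)
    (≤-reflexive (p≥q⇒p⊔q≡p (fm≤ a (ℕₚ.≤-trans a≤b (ℕₚ.≤-trans b≤m m≤i)))))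
  nondecreasing : ∀ a b → m ℕ.≤ a → a ℕ.≤ b → b ℕ.≤ i → f a ℚ.≤ f b
  nondecreasing a b m≤a a≤b b≤i = ≤-trans (quasiconvex m a b m≤a a≤b b≤i)
    (≤-reflexive (p≤q⇒p⊔q≡q (fm≤ b b≤i)))

mainTheorem16 :
    (n : ℕ) (I : Instance n) (k : ℕ) → 1 ℕ.≤ k → k ℕ.≤ suc n →
    (opt : Scenario → ℚ) →
    (∀ s → IsScenario I s → IsOptValue I k s (opt s)) →
    (Rt : ℕ → ℕ → ℕ → ℚ) →
    (∀ l r t → l ℕ.≤ t → t ℕ.≤ r → r ℕ.≤ n →
      WithOpt.IsRValue I k opt l r t (Rt l r t)) →
    (M : ℕ → ℕ → ℚ) →
    (∀ q i → 1 ℕ.≤ q → i ℕ.≤ n → IsMValue I Rt q i (M q i)) →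
    (q i : ℕ) → 2 ℕ.≤ q → i ℕ.≤ n →
    UnimodalOn i (objective I Rt M q i)
mainTheorem16 n I k _ _ opt _ Rt Rt-isR M M-isM q i 2≤q i≤n = quasiconvex⇒unimodal i f quasiconvex
  where
  open Regret I k opt Rt Rt-isR

  f : ℕ → ℚ
  f = objective I Rt M q i

  M≤f : ∀ j → M (q ∸ 1) j ℚ.≤ f (suc j)
  M≤f j = p≤p⊔q (M (q ∸ 1) j) (Rlr I Rt (suc j) i)

  Rlr≤f : ∀ j → Rlr I Rt j i ℚ.≤ f j
  Rlr≤f zero    = ≤-refl
  Rlr≤f (suc j) = p≤q⊔p (M (q ∸ 1) j) (Rlr I Rt (suc j) i)

  quasiconvex : QuasiconvexOn i f
  quasiconvex .0 zero    c       z≤n   _         _     = p≤p⊔q (f 0) (f c)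
  quasiconvex a  (suc b) (suc c) a≤1+b (s≤s b≤c) 1+c≤i = ⊔-lub
    (p≤q⇒p≤r⊔q (f a) (≤-trans (M-mono M M-isM (ℕₚ.∸-monoˡ-≤ 1 2≤q) b≤c c≤n) (M≤f c)))
    (p≤q⇒p≤q⊔r (f (suc c)) (≤-trans (Rlr-antitoneˡ a≤1+b 1+b≤i i≤n) (Rlr≤f a)))
    where
    c≤n : c ℕ.≤ n
    c≤n = ℕₚ.<⇒≤ (ℕₚ.≤-trans 1+c≤i i≤n)
    1+b≤i : suc b ℕ.≤ i
    1+b≤i = ℕₚ.≤-trans (s≤s b≤c) 1+c≤i
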